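{- Let $1\le m\le n$ be integers. The map $\pi\mapsto(\vec r(\pi),\sigma(\pi))$ is a bijection from $\mathrm{PF}(m,n)$ onto $\mathscr C(m,n)$.
   Context: $\mathrm{PF}(m,n)$ is the set of parking functions with $m$ cars and $n$ spots: sequences $\pi=(\pi_1,\dots,\pi_m)\in\{1,\dots,n\}^m$ such that, when spots $1,\dots,n$ are initially empty and for $i=1,\dots,m$ in turn car $i$ parks in the first empty spot among $\pi_i,\pi_i+1,\dots,n$, every car succeeds in parking. For $\pi\in\{1,\dots,n\}^m$, its specification is $\vec r(\pi)=(r_1,\dots,r_n)$ with $r_k=\#\{i:\pi_i=k\}$, and its order permutation $\sigma(\pi)\in\mathfrak S_m$ is given by $\sigma_i=\#\{j:\pi_j<\pi_i,\text{ or }\pi_j=\pi_i\text{ and }j\le i\}$. A pair $(\vec r,\sigma)$ with $\vec r=(r_1,\dots,r_n)$ a vector of nonnegative integers and $\sigma\in\mathfrak S_m$ is called compatible if for every $k\in\{1,\dots,n\}$ the values $1+\sum_{i=1}^{k-1}r_i,\dots,\sum_{i=1}^k r_i$ appear from left to right in the word $\sigma=\sigma_1\sigma_2\cdots\sigma_m$; $\vec r$ is called balanced if there exist integers $0=:k_0<k_1<\dots<k_{n-m}<k_{n-m+1}:=n+1$ such that $\sum_{s=1}^{k_i}r_s=k_i-i$ for all $1\le i\le n-m$, $\sum_{s=1}^j r_s>j-i-1$ for all $k_i<j<k_{i+1}$ and $0\le i\le n-m$, and $\sum_{s=1}^n r_s=m$. $\mathscr C(m,n)$ is the set of compatible pairs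 $(\vec r,\sigma)$ with $\vec r$ balanced. -}

module Defs where

open import Data.Nat using (ℕ; zero; suc; _+_; _∸_; _≤_; _<_; _≟_; _<?_; _≤?_)
open import Data.Fin using (Fin; toℕ)
open import Data.List using (List; []; _∷_; length; filter; take; _++_; [_])
open import Data.Nat.ListAction using (sum)
open import Data.List.Membership.DecPropositional _≟_ using (_∈?_)
open import Data.Vec using (Vec; toList; tabulate; lookup; allFin)
import Data.Vec as V
open import Data.Maybe using (Maybe; just; nothing)
open import Data.Product using (Σ; ∃; _×_; _,_)
open import Data.Sum using (_⊎_)
open import Relation.Nullary using (yes; no; does)
open import Relation.Nullary.Decidable using (_×-dec_; _⊎-dec_)
open import Relation.Binary.PropositionalEquality using (_≡_)

-- Parking process (spots and preferences are 1-indexed natural numbers)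

firstFree : List ℕ → ℕ → ℕ → Maybe ℕ
firstFree occ p zero = nothing
firstFree occ p (suc k) with p ∈? occ
... | yes _ = firstFree occ (suc p) k
... | no  _ = just p

parkCar : (n : ℕ) → List ℕ → ℕ → Maybe ℕ
parkCar n occ p = firstFree occ p (suc n ∸ p)

parkAll : (n : ℕ) → List ℕ → List ℕ → Maybe (List ℕ)
parkAll n occ [] = just occ
parkAll n occ (p ∷ ps) with parkCar n occ p
... | nothing = nothing
... | just s  = parkAll n (s ∷ occ) ps

IsPF : (m n : ℕ) → Vec ℕ m → Set
IsPF m n π = ((i : Fin m) → 1 ≤ lookup π i × lookup π i ≤ n)
           × ∃ λ occ → parkAll n [] (toList π) ≡ just occ

countEq : ℕ → List ℕ → ℕ
countEq k xs = length (filter (λ x → x ≟ k) xs)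

-- r_k = #{i : π_i = k}, k = 1..n  (entry at Fin index k is r_{k+1})
spec : (n : ℕ) → {m : ℕ} → Vec ℕ m → Vec ℕ n
spec n π = tabulate (λ k → countEq (suc (toℕ k)) (toList π))

ord : {m : ℕ} → Vec ℕ m → Vec ℕ m
ord {m} π = tabulate λ i →
  length (filter (λ j → (lookup π j <? lookup π i)
                         ⊎-dec ((lookup π j ≟ lookup π i) ×-dec (toℕ j ≤? toℕ i)))
                 (toList (allFin m)))

psum : {n : ℕ} → Vec ℕ n → ℕ → ℕ
psum r k = sum (take k (toList r))

IsPerm : (m : ℕ) → Vec ℕ m → Set
IsPerm m σ = ((i : Fin m) → 1 ≤ lookup σ i × lookup σ i ≤ m)
           × ((i j : Fin m) → lookup σ i ≡ lookup σ j → i ≡ j)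

-- for each k ∈ {1..n}, the values 1+S_{k-1}, …, S_k appear from left to right in σ
Compatible : {m n : ℕ} → Vec ℕ n → Vec ℕ m → Set
Compatible {m} {n} r σ =
  (k : ℕ) → 1 ≤ k → k ≤ n → (i j : Fin m) → toℕ i < toℕ j →
  psum r (k ∸ 1) < lookup σ i → lookup σ i ≤ psum r k →
  psum r (k ∸ 1) < lookup σ j → lookup σ j ≤ psum r k →
  lookup σ i < lookup σ j

nth : List ℕ → ℕ → ℕ
nth [] _ = 0
nth (x ∷ xs) zero = x
nth (x ∷ xs) (suc i) = nth xs i

-- K_0 = 0, K_1 … K_{n-m} = ks, K_{n-m+1} = n+1
fullK : (n : ℕ) → List ℕ → List ℕ
fullK n ks = 0 ∷ (ks ++ [ suc n ])

Balanced : (m n : ℕ) → Vec ℕ n → Set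
Balanced m n r = Σ (List ℕ) λ ks →
    length ks ≡ n ∸ m
  × ((i : ℕ) → i ≤ n ∸ m → nth (fullK n ks) i < nth (fullK n ks) (suc i))
  × ((i : ℕ) → 1 ≤ i → i ≤ n ∸ m → psum r (nth (fullK n ks) i) ≡ nth (fullK n ks) i ∸ i)
  -- S_j > j - i - 1 (over ℤ), written as j < S_j + i + 1
  × ((i j : ℕ) → i ≤ n ∸ m → nth (fullK n ks) i < j → j < nth (fullK n ks) (suc i) →
       j < psum r j + i + 1)
  × psum r n ≡ m

InC : (m n : ℕ) → Vec ℕ n → Vec ℕ m → Set
InC m n r σ = IsPerm m σ × Compatible r σ × Balanced m n r

-- Write S_j = r_1 + ⋯ + r_j.  For π ∈ {1,…,n}^m, S_j(r(π)) is the number of cars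
-- preferring a spot ≤ j, and σ_i(π) is the rank of car i when cars are ordered by
-- (preference, arrival); so σ_i lies in the block (S_{π_i − 1}, S_{π_i}] and cars with
-- equal preference receive increasing ranks.  This makes (r(π), σ(π)) compatible, and
-- π_i is recovered as the block containing σ_i, which gives injectivity; for a
-- compatible pair, putting π_i := the block containing σ_i inverts the map.
-- By the classical criterion π parks iff, for every j < n, at most n − j cars prefer a
-- spot above j, i.e. iff S_j ≥ j − (n − m); when S_n = m these lower bounds are
-- equivalent to r being balanced, k_i being the least j with S_j ≤ j − i.
module Submission where

open import Level using (0ℓ)
open import Function using (_∘_; id)
open import Data.Empty using (⊥-elim)
open import Data.Product using (Σ; ∃; _×_; _,_; proj₁; proj₂)
open import Data.Product.Properties using (×-≡,≡→≡)
import Data.Product.Relation.Binary.Lex.Strict as Lex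
open import Data.Sum using (_⊎_; inj₁; inj₂; [_,_]′; map₂)
open import Data.Maybe using (just; nothing)
open import Data.Nat using (ℕ; zero; suc; _+_; _∸_; _≤_; _≰_; _<_; z≤n; s≤s; z<s)
open import Data.Nat.Properties
open import Data.Nat.ListAction using (sum)
open import Data.Nat.Solver using (module +-*-Solver)
open +-*-Solver using (solve; _:+_; _:=_)
open import Data.Fin as Fin using (Fin; toℕ; fromℕ<)
open import Data.Fin.Properties using (toℕ<n; toℕ-fromℕ<; toℕ-injective)
open import Data.List as List using (List; []; _∷_; length; filter; map; take; _++_; [_]; applyUpTo)
open import Data.List.Properties
  using (length-applyUpTo; length-tabulate; map-tabulate; length-filter;
         filter-all; filter-none; filter-some; filter-accept; filter-reject; filter-≐)
open import Data.List.Membership.Propositional using (_∈_; _∉_)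
open import Data.List.Membership.Propositional.Properties using (∈-allFin)
open import Data.List.Membership.DecPropositional _≟_ using (_∈?_)
open import Data.List.Relation.Unary.All as All using (All; []; _∷_)
import Data.List.Relation.Unary.All.Properties as AllP
open import Data.List.Relation.Unary.Any as Any using (here; there)
open import Data.List.Relation.Unary.AllPairs using (_∷_)
open import Data.List.Relation.Unary.Unique.Propositional using (Unique)
import Data.List.Relation.Unary.Unique.Propositional.Properties as Unique
import Data.List.Relation.Binary.Sublist.Propositional as Sublist
import Data.List.Relation.Binary.Sublist.Propositional.Properties as Sublist
open import Data.Vec as V using (Vec; toList; lookup)
open import Data.Vec.Properties using (tabulate∘lookup; lookup∘tabulate; length-toList)
open import Data.Vec.Relation.Binary.Pointwise.Extensional using (ext; Pointwise-≡⇒≡)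
open import Relation.Nullary using (yes; no; ¬_)
open import Relation.Nullary.Negation using (contradiction)
open import Relation.Unary using (Pred; Decidable; _⊆_; _≐_; _∩_)
open import Relation.Unary.Properties using (_∩?_; ∁?)
open import Relation.Binary.Core using (Rel)
open import Relation.Binary.Definitions using (Transitive; Total; tri<; tri≈; tri>)
  renaming (Decidable to Decidable₂)
open import Relation.Binary.PropositionalEquality hiding ([_])

open import Defs

-- Counting

count : {A : Set} {P : Pred A 0ℓ} → Decidable P → List A → ℕ
count P? xs = length (filter P? xs)

module _ {A : Set} {P : Pred A 0ℓ} (P? : Decidable P) where

  count-complement : ∀ xs → count P? xs + count (∁? P?) xs ≡ length xs
  count-complement [] = refl
  count-complement (x ∷ xs) with P? x
  ... | yes _ = cong suc (count-complement xs)
  ... | no  _ = trans (+-suc _ _) (cong suc (count-complement xs))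

  count-accept : ∀ {x xs} → P x → count P? (x ∷ xs) ≡ suc (count P? xs)
  count-accept px = cong length (filter-accept P? px)

  count-reject : ∀ {x xs} → ¬ P x → count P? (x ∷ xs) ≡ count P? xs
  count-reject ¬px = cong length (filter-reject P? ¬px)

  count-≤-∷ : ∀ {x} xs → count P? xs ≤ count P? (x ∷ xs)
  count-≤-∷ {x} xs with P? x
  ... | yes _ = n≤1+n _
  ... | no  _ = ≤-refl

  count-map : {B : Set} (f : B → A) → ∀ xs → count P? (map f xs) ≡ count (P? ∘ f) xs
  count-map f [] = refl
  count-map f (x ∷ xs) with P? (f x)
  ... | yes _ = cong suc (count-map f xs)
  ... | no  _ = count-map f xs

module _ {A : Set} {P Q : Pred A 0ℓ} (P? : Decidable P) (Q? : Decidable Q) where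

  count-mono : P ⊆ Q → ∀ xs → count P? xs ≤ count Q? xs
  count-mono P⊆Q xs =
    Sublist.length-mono-≤ (Sublist.filter⁺ P? Q? (λ { refl → P⊆Q }) (Sublist.⊆-refl {x = xs}))

  count-cong : P ≐ Q → ∀ xs → count P? xs ≡ count Q? xs
  count-cong P≐Q xs = cong length (filter-≐ P? Q? P≐Q xs)

  count-split : ∀ xs → count P? xs ≡ count (P? ∩? Q?) xs + count (P? ∩? ∁? Q?) xs
  count-split [] = refl
  count-split (x ∷ xs) with P? x | Q? x
  ... | yes _ | yes _ = cong suc (count-split xs)
  ... | yes _ | no  _ = trans (cong suc (count-split xs)) (sym (+-suc _ _))
  ... | no  _ | yes _ = count-split xs
  ... | no  _ | no  _ = count-split xs

module _ {A : Set} {P Q : Pred A 0ℓ} (P? : Decidable P) (Q? : Decidable Q) where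

  count-< : P ⊆ Q → ∀ {xs y} → y ∈ xs → Q y → ¬ P y → count P? xs < count Q? xs
  count-< P⊆Q {xs} y∈xs qy ¬py = begin-strict
    count P? xs                                          ≡⟨ count-cong P? (Q? ∩? P?) ((λ p → P⊆Q p , p) , proj₂) xs ⟩
    count (Q? ∩? P?) xs                                  <⟨ m<m+n _ (filter-some (Q? ∩? ∁? P?) (Any.map (λ { refl → qy , ¬py }) y∈xs)) ⟩
    count (Q? ∩? P?) xs + count (Q? ∩? ∁? P?) xs         ≡⟨ count-split Q? P? xs ⟨
    count Q? xs                                          ∎
    where open ≤-Reasoning

count-≡-unique : ∀ {c} {xs : List ℕ} → Unique xs → count (_≟ c) xs ≤ 1
count-≡-unique {xs = []} _ = z≤n
count-≡-unique {c} {x ∷ xs} (x∉xs ∷ u) with x ≟ c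
... | yes refl = ≤-reflexive (begin
      count (_≟ x) (x ∷ xs)   ≡⟨ count-accept (_≟ x) refl ⟩
      suc (count (_≟ x) xs)   ≡⟨ cong (suc ∘ length) (filter-none (_≟ x) (All.map (_∘ sym) x∉xs)) ⟩
      1                       ∎)
  where open ≡-Reasoning
... | no x≢c = ≤-trans (≤-reflexive (count-reject (_≟ c) x≢c)) (count-≡-unique u)

all-filter : ∀ {A : Set} {P Q : Pred A 0ℓ} (P? : Decidable P) {xs} → All Q xs → All (Q ∩ P) (filter P? xs)
all-filter P? {xs} qs = All.zip (AllP.filter⁺ P? qs , AllP.all-filter P? xs)

unique-length-≤ : ∀ {a} l {xs : List ℕ} → Unique xs → All (λ x → a ≤ x × x < a + l) xs → length xs ≤ l
unique-length-≤ {a} zero {[]} _ _ = z≤n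
unique-length-≤ {a} zero {x ∷ _} _ ((a≤x , x<a+0) ∷ _) = contradiction (≤-trans x<a+0 (≤-reflexive (+-identityʳ a))) (<⇒≱ (s≤s a≤x))
unique-length-≤ {a} (suc l) {xs} u bounds = begin
  length xs                                       ≡⟨ count-complement (_≟ a + l) xs ⟨
  count (_≟ a + l) xs + count (∁? (_≟ a + l)) xs  ≤⟨ +-mono-≤ (count-≡-unique u) rest ⟩
  suc l                                           ∎
  where
  open ≤-Reasoning
  rest : count (∁? (_≟ a + l)) xs ≤ l
  rest = unique-length-≤ l (Unique.filter⁺ (∁? (_≟ a + l)) u)
    (All.map (λ { ((a≤x , x<) , x≢) → a≤x , ≤∧≢⇒< (≤-pred (≤-trans x< (≤-reflexive (+-suc a l)))) x≢ })
      (all-filter (∁? (_≟ a + l)) bounds))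

toList-tabulate : ∀ {A : Set} {m} (f : Fin m → A) → toList (V.tabulate f) ≡ List.tabulate f
toList-tabulate {m = zero} f = refl
toList-tabulate {m = suc m} f = cong (f Fin.zero ∷_) (toList-tabulate (f ∘ Fin.suc))

toList-lookup : ∀ {A : Set} {m} (v : Vec A m) → toList v ≡ List.tabulate (lookup v)
toList-lookup v = trans (cong toList (sym (tabulate∘lookup v))) (toList-tabulate (lookup v))

count-toList : ∀ {A : Set} {P : Pred A 0ℓ} (P? : Decidable P) {m} (v : Vec A m) →
               count P? (toList v) ≡ count (P? ∘ lookup v) (List.allFin m)
count-toList P? {m} v = begin
  count P? (toList v)                              ≡⟨ cong (count P?) (toList-lookup v) ⟩
  count P? (List.tabulate (lookup v))              ≡⟨ cong (count P?) (map-tabulate id (lookup v)) ⟨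
  count P? (map (lookup v) (List.allFin m))        ≡⟨ count-map P? (lookup v) (List.allFin m) ⟩
  count (P? ∘ lookup v) (List.allFin m)            ∎
  where open ≡-Reasoning

count-allFin-≤ : ∀ {m} {P : Pred (Fin m) 0ℓ} (P? : Decidable P) → count P? (List.allFin m) ≤ m
count-allFin-≤ {m} P? = ≤-trans (length-filter P? (List.allFin m)) (≤-reflexive (length-tabulate id))

vec-ext : ∀ {A : Set} {m} {v w : Vec A m} → (∀ i → lookup v i ≡ lookup w i) → v ≡ w
vec-ext h = Pointwise-≡⇒≡ (ext h)

-- Partial sums

nth-toList : ∀ {n} (r : Vec ℕ n) (i : Fin n) → nth (toList r) (toℕ i) ≡ lookup r i
nth-toList (x V.∷ r) Fin.zero = refl
nth-toList (x V.∷ r) (Fin.suc i) = nth-toList r i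

sum-take-suc : ∀ (xs : List ℕ) j → sum (take (suc j) xs) ≡ sum (take j xs) + nth xs j
sum-take-suc [] zero = refl
sum-take-suc [] (suc j) = refl
sum-take-suc (x ∷ xs) zero = +-comm x 0
sum-take-suc (x ∷ xs) (suc j) = trans (cong (x +_) (sum-take-suc xs j)) (sym (+-assoc x _ _))

psum-suc : ∀ {n} (r : Vec ℕ n) (i : Fin n) → psum r (suc (toℕ i)) ≡ psum r (toℕ i) + lookup r i
psum-suc r i = trans (sum-take-suc (toList r) (toℕ i)) (cong (psum r (toℕ i) +_) (nth-toList r i))

psum-mono : ∀ {n} (r : Vec ℕ n) {a b} → a ≤ b → psum r a ≤ psum r b
psum-mono r {b = zero} z≤n = ≤-refl
psum-mono r {a} {suc b} a≤1+b with m≤n⇒m<n∨m≡n a≤1+b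
... | inj₂ refl = ≤-refl
... | inj₁ a<1+b = ≤-trans (psum-mono r (≤-pred a<1+b))
                     (≤-trans (m≤m+n _ _) (≤-reflexive (sym (sum-take-suc (toList r) b))))

psum-injective : ∀ {n} {r r′ : Vec ℕ n} → (∀ j → j ≤ n → psum r j ≡ psum r′ j) → r ≡ r′
psum-injective {r = r} {r′} h = vec-ext λ i → +-cancelˡ-≡ (psum r (toℕ i)) _ _ (begin
  psum r (toℕ i) + lookup r i    ≡⟨ psum-suc r i ⟨
  psum r (suc (toℕ i))           ≡⟨ h (suc (toℕ i)) (toℕ<n i) ⟩
  psum r′ (suc (toℕ i))          ≡⟨ psum-suc r′ i ⟩
  psum r′ (toℕ i) + lookup r′ i  ≡⟨ cong (_+ lookup r′ i) (h (toℕ i) (<⇒≤ (toℕ<n i))) ⟨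
  psum r (toℕ i) + lookup r′ i   ∎)
  where open ≡-Reasoning

InBlock : ∀ {n} → Vec ℕ n → ℕ → ℕ → Set
InBlock r k x = psum r (k ∸ 1) < x × x ≤ psum r k

inBlock-unique : ∀ {n} (r : Vec ℕ n) {a b x} → 1 ≤ a → 1 ≤ b → InBlock r a x → InBlock r b x → a ≡ b
inBlock-unique r {suc a} {suc b} _ _ (lo , hi) (lo′ , hi′) with <-cmp a b
... | tri< a<b _ _ = contradiction (≤-trans hi (psum-mono r a<b)) (<⇒≱ lo′)
... | tri≈ _ a≡b _ = cong suc a≡b
... | tri> _ _ b<a = contradiction (≤-trans hi′ (psum-mono r b<a)) (<⇒≱ lo)

Minimal : (ℕ → Set) → ℕ → Set
Minimal P k = P k × (∀ {j} → j < k → ¬ P j)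

minimal-≤ : ∀ {P k j} → Minimal P k → P j → k ≤ j
minimal-≤ (_ , below) pj = ≮⇒≥ (λ j<k → below j<k pj)

-- the least k ≤ n with P k, or n if there is none
search : {P : ℕ → Set} → Decidable P → ℕ → ℕ
search P? zero = zero
search P? (suc n) with P? zero
... | yes _ = zero
... | no  _ = suc (search (P? ∘ suc) n)

search-minimal : {P : ℕ → Set} (P? : Decidable P) → ∀ {n} → P n → Minimal P (search P? n)
search-minimal P? {zero} p0 = p0 , λ ()
search-minimal P? {suc n} pn with P? zero
... | yes p0 = p0 , λ ()
... | no ¬p0 with search-minimal (P? ∘ suc) pn
... | pk , below = pk , λ { {zero} _ → ¬p0 ; {suc j} (s≤s j<k) → below j<k }

-- The parking process

occupied : List ℕ → ℕ → ℕ → ℕ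
occupied O a zero = 0
occupied O a (suc l) with a ∈? O
... | yes _ = suc (occupied O (suc a) l)
... | no  _ = occupied O (suc a) l

occupied-≤ : ∀ O a l → occupied O a l ≤ l
occupied-≤ O a zero = z≤n
occupied-≤ O a (suc l) with a ∈? O
... | yes _ = s≤s (occupied-≤ O (suc a) l)
... | no  _ = m≤n⇒m≤1+n (occupied-≤ O (suc a) l)

occupied-[] : ∀ a l → occupied [] a l ≡ 0
occupied-[] a zero = refl
occupied-[] a (suc l) = occupied-[] (suc a) l

occupied-full : ∀ O a l → (∀ {v} → a ≤ v → v < a + l → v ∈ O) → occupied O a l ≡ l
occupied-full O a zero _ = refl
occupied-full O a (suc l) full with a ∈? O
... | yes _ = cong suc (occupied-full O (suc a) l λ a<v v< → full (<⇒≤ a<v) (≤-trans v< (≤-reflexive (sym (+-suc a l)))))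
... | no a∉O = contradiction (full ≤-refl (m<m+n a z<s)) a∉O

occupied-∷-≤ : ∀ s O a l → occupied O a l ≤ occupied (s ∷ O) a l
occupied-∷-≤ s O a zero = z≤n
occupied-∷-≤ s O a (suc l) with a ∈? O | a ∈? (s ∷ O)
... | yes _   | yes _    = s≤s (occupied-∷-≤ s O (suc a) l)
... | yes a∈O | no a∉s∷O = contradiction (there a∈O) a∉s∷O
... | no  _   | yes _    = m≤n⇒m≤1+n (occupied-∷-≤ s O (suc a) l)
... | no  _   | no  _    = occupied-∷-≤ s O (suc a) l

occupied-∷-outside : ∀ s O a l → s < a → occupied (s ∷ O) a l ≡ occupied O a l
occupied-∷-outside s O a zero _ = refl
occupied-∷-outside s O a (suc l) s<a with a ∈? O | a ∈? (s ∷ O)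
... | yes _   | yes _            = cong suc (occupied-∷-outside s O (suc a) l (m≤n⇒m≤1+n s<a))
... | yes a∈O | no a∉s∷O         = contradiction (there a∈O) a∉s∷O
... | no  _   | yes (here refl)  = contradiction s<a (<-irrefl refl)
... | no a∉O  | yes (there a∈O)  = contradiction a∈O a∉O
... | no  _   | no  _            = occupied-∷-outside s O (suc a) l (m≤n⇒m≤1+n s<a)

occupied-∷-inside : ∀ s O a l → s ∉ O → a ≤ s → s < a + l → occupied (s ∷ O) a l ≡ suc (occupied O a l)
occupied-∷-inside s O a zero _ a≤s s<a+0 = contradiction (≤-trans s<a+0 (≤-reflexive (+-identityʳ a))) (<⇒≱ (s≤s a≤s))
occupied-∷-inside s O a (suc l) s∉O a≤s s< with a ∈? O | a ∈? (s ∷ O)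
... | yes a∈O | yes _            = cong suc (occupied-∷-inside s O (suc a) l s∉O (≤∧≢⇒< a≤s λ { refl → s∉O a∈O }) s<′)
  where s<′ = ≤-trans s< (≤-reflexive (+-suc a l))
... | yes a∈O | no a∉s∷O         = contradiction (there a∈O) a∉s∷O
... | no  _   | yes (here refl)  = cong suc (occupied-∷-outside a O (suc a) l ≤-refl)
... | no a∉O  | yes (there a∈O)  = contradiction a∈O a∉O
... | no  _   | no a∉s∷O         = occupied-∷-inside s O (suc a) l s∉O (≤∧≢⇒< a≤s (a∉s∷O ∘ here)) s<′
  where s<′ = ≤-trans s< (≤-reflexive (+-suc a l))

∈-step-down : ∀ {O : List ℕ} {Q : Pred ℕ 0ℓ} {y} → y ∈ O → (∀ {v} → y < v → Q v → v ∈ O) →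
              ∀ {v} → y ≤ v → Q v → v ∈ O
∈-step-down {y = y} y∈O above {v} y≤v qv with y ≟ v
... | yes refl = y∈O
... | no  y≢v  = above (≤∧≢⇒< y≤v y≢v) qv

firstFree-just : ∀ O p f {s} → firstFree O p f ≡ just s →
                 p ≤ s × s < p + f × s ∉ O × (∀ {v} → p ≤ v → v < s → v ∈ O)
firstFree-just O p zero ()
firstFree-just O p (suc f) eq with p ∈? O
firstFree-just O p (suc f) refl | no p∉O = ≤-refl , m<m+n p z<s , p∉O , λ p≤v v<p → contradiction p≤v (<⇒≱ v<p)
... | yes p∈O with firstFree-just O (suc p) f eq
... | p<s , s< , s∉O , skipped = <⇒≤ p<s , ≤-trans s< (≤-reflexive (sym (+-suc p f))) , s∉O , ∈-step-down p∈O skipped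

firstFree-nothing : ∀ O p f → firstFree O p f ≡ nothing → ∀ {v} → p ≤ v → v < p + f → v ∈ O
firstFree-nothing O p zero _ p≤v v<p+0 = contradiction (≤-trans v<p+0 (≤-reflexive (+-identityʳ p))) (<⇒≱ (s≤s p≤v))
firstFree-nothing O p (suc f) eq p≤v v< with p ∈? O
firstFree-nothing O p (suc f) () p≤v v< | no _
... | yes p∈O = ∈-step-down p∈O (λ p<w w< → firstFree-nothing O (suc p) f eq p<w (≤-trans w< (≤-reflexive (+-suc p f)))) p≤v v<

SuffixBounded : ℕ → List ℕ → Set
SuffixBounded n xs = ∀ j → j < n → count (j <?_) xs ≤ n ∸ j

-- spot 0 is not a real spot and serves as a permanently free boundary
Boundary : List ℕ → ℕ → Set
Boundary O j = j ≡ 0 ⊎ j ∉ O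

boundary-∷⁻ : ∀ {s O j} → Boundary (s ∷ O) j → Boundary O j
boundary-∷⁻ = map₂ (_∘ there)

module _ (n : ℕ) where

  occupiedAbove : List ℕ → ℕ → ℕ
  occupiedAbove O j = occupied O (suc j) (n ∸ j)

  parkCar-just : ∀ {O x s} → parkCar n O x ≡ just s →
                 x ≤ s × s ≤ n × s ∉ O × (∀ {v} → x ≤ v → v < s → v ∈ O)
  parkCar-just {O} {x} {s} eq with firstFree-just O x (suc n ∸ x) eq
  ... | x≤s , s< , s∉O , skipped = x≤s , s≤n , s∉O , skipped
    where
    s≤n : s ≤ n
    s≤n with x ≤? n
    ... | yes x≤n = ≤-pred (≤-trans s< (≤-reflexive (m+[n∸m]≡n (m≤n⇒m≤1+n x≤n))))
    ... | no  x≰n = contradiction (≤-trans s< (≤-reflexive (trans (cong (x +_) (m≤n⇒m∸n≡0 (≰⇒> x≰n))) (+-identityʳ x))))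
                                  (<⇒≱ (s≤s x≤s))

  parkCar-nothing : ∀ {O x} → parkCar n O x ≡ nothing → ∀ {v} → x ≤ v → v ≤ n → v ∈ O
  parkCar-nothing {O} {x} eq x≤v v≤n =
    firstFree-nothing O x (suc n ∸ x) eq x≤v (≤-trans (s≤s v≤n) (m≤n+m∸n (suc n) x))

  occupiedAbove-inside : ∀ {O s j} → j < n → s ∉ O → j < s → s ≤ n → occupiedAbove (s ∷ O) j ≡ suc (occupiedAbove O j)
  occupiedAbove-inside {O} {s} {j} j<n s∉O j<s s≤n =
    occupied-∷-inside s O (suc j) (n ∸ j) s∉O j<s (≤-trans (s≤s s≤n) (≤-reflexive (sym (m+[n∸m]≡n (<⇒≤ (s≤s j<n))))))

  parkAll-occupiedAbove : ∀ {O O′} xs → parkAll n O xs ≡ just O′ → ∀ j → j < n →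
                          count (j <?_) xs + occupiedAbove O j ≤ occupiedAbove O′ j
  parkAll-occupiedAbove [] refl j _ = ≤-refl
  parkAll-occupiedAbove {O} {O′} (x ∷ xs) eq j j<n with parkCar n O x in parked
  ... | just s with parkCar-just parked | j <? x
  ...   | x≤s , s≤n , s∉O , _ | yes j<x = begin
          count (j <?_) (x ∷ xs) + occupiedAbove O j          ≡⟨ cong (_+ occupiedAbove O j) (count-accept (j <?_) j<x) ⟩
          suc (count (j <?_) xs) + occupiedAbove O j          ≡⟨ +-suc _ _ ⟨
          count (j <?_) xs + suc (occupiedAbove O j)          ≡⟨ cong (count (j <?_) xs +_) (occupiedAbove-inside j<n s∉O (<-≤-trans j<x x≤s) s≤n) ⟨
          count (j <?_) xs + occupiedAbove (s ∷ O) j          ≤⟨ parkAll-occupiedAbove xs eq j j<n ⟩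
          occupiedAbove O′ j                                  ∎
    where open ≤-Reasoning
  ...   | _ | no j≮x = begin
          count (j <?_) (x ∷ xs) + occupiedAbove O j          ≡⟨ cong (_+ occupiedAbove O j) (count-reject (j <?_) j≮x) ⟩
          count (j <?_) xs + occupiedAbove O j                ≤⟨ +-monoʳ-≤ _ (occupied-∷-≤ s O (suc j) (n ∸ j)) ⟩
          count (j <?_) xs + occupiedAbove (s ∷ O) j          ≤⟨ parkAll-occupiedAbove xs eq j j<n ⟩
          occupiedAbove O′ j                                  ∎
    where open ≤-Reasoning

  parks⇒suffixBounded : ∀ {O′} xs → parkAll n [] xs ≡ just O′ → SuffixBounded n xs
  parks⇒suffixBounded {O′} xs eq j j<n = begin
    count (j <?_) xs                             ≡⟨ +-identityʳ _ ⟨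
    count (j <?_) xs + 0                         ≡⟨ cong (count (j <?_) xs +_) (occupied-[] (suc j) (n ∸ j)) ⟨
    count (j <?_) xs + occupiedAbove [] j        ≤⟨ parkAll-occupiedAbove xs eq j j<n ⟩
    occupiedAbove O′ j                           ≤⟨ occupied-≤ O′ (suc j) (n ∸ j) ⟩
    n ∸ j                                        ∎
    where open ≤-Reasoning

  Room : List ℕ → List ℕ → Set
  Room O xs = ∀ j → j < n → Boundary O j → occupiedAbove O j + count (j <?_) xs ≤ n ∸ j

  lastBoundary : ∀ {O} y → (∀ {v} → suc y ≤ v → v ≤ n → v ∈ O) →
                 ∃ λ j → j ≤ y × Boundary O j × (∀ {v} → j < v → v ≤ n → v ∈ O)
  lastBoundary zero full = 0 , z≤n , inj₁ refl , full
  lastBoundary {O} (suc y) full with suc y ∈? O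
  ... | no y∉O = suc y , ≤-refl , inj₂ y∉O , full
  ... | yes y∈O with lastBoundary y (∈-step-down y∈O full)
  ... | j , j≤y , boundary , full′ = j , m≤n⇒m≤1+n j≤y , boundary , full′

  room-∷ : ∀ {O x s xs} → 1 ≤ x → parkCar n O x ≡ just s → Room O (x ∷ xs) → Room (s ∷ O) xs
  room-∷ {O} {x} {s} {xs} 1≤x parked room j j<n boundary with parkCar-just parked | j <? s
  ... | x≤s , s≤n , s∉O , skipped | yes j<s = begin
    occupiedAbove (s ∷ O) j + count (j <?_) xs        ≡⟨ cong (_+ count (j <?_) xs) (occupiedAbove-inside j<n s∉O j<s s≤n) ⟩
    suc (occupiedAbove O j) + count (j <?_) xs        ≡⟨ +-suc _ _ ⟨
    occupiedAbove O j + suc (count (j <?_) xs)        ≡⟨ cong (occupiedAbove O j +_) (count-accept (j <?_) (below-car boundary)) ⟨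
    occupiedAbove O j + count (j <?_) (x ∷ xs)        ≤⟨ room j j<n (boundary-∷⁻ boundary) ⟩
    n ∸ j                                             ∎
    where
    open ≤-Reasoning
    -- car x found every spot in [x, s) occupied
    below-car : Boundary (s ∷ O) j → j < x
    below-car (inj₁ refl) = 1≤x
    below-car (inj₂ j∉s∷O) = ≰⇒> λ x≤j → j∉s∷O (there (skipped x≤j j<s))
  ... | _ | no j≮s = begin
    occupiedAbove (s ∷ O) j + count (j <?_) xs        ≡⟨ cong (_+ count (j <?_) xs) (occupied-∷-outside s O (suc j) (n ∸ j) (s≤s (≮⇒≥ j≮s))) ⟩
    occupiedAbove O j + count (j <?_) xs              ≤⟨ +-monoʳ-≤ _ (count-≤-∷ (j <?_) {x} xs) ⟩
    occupiedAbove O j + count (j <?_) (x ∷ xs)        ≤⟨ room j j<n (boundary-∷⁻ boundary) ⟩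
    n ∸ j                                             ∎
    where open ≤-Reasoning

  room⇒parks : ∀ {O} xs → All (λ x → 1 ≤ x × x ≤ n) xs → Room O xs → ∃ λ O′ → parkAll n O xs ≡ just O′
  room⇒parks {O} [] _ _ = O , refl
  room⇒parks (zero ∷ _) ((() , _) ∷ _) _
  room⇒parks {O} (suc y ∷ xs) ((1≤x , x≤n) ∷ bounds) room with parkCar n O (suc y) in parked
  ... | just s = room⇒parks xs bounds (room-∷ 1≤x parked room)
  -- every spot from x on is taken, so the last boundary below x has no room left for car x
  ... | nothing with lastBoundary y (parkCar-nothing parked)
  ...   | j , j≤y , boundary , fullAbove = contradiction (room j j<n boundary) overfull
    where
    j<x : j < suc y
    j<x = s≤s j≤y
    j<n : j < n
    j<n = <-≤-trans j<x x≤n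
    full : occupiedAbove O j ≡ n ∸ j
    full = occupied-full O (suc j) (n ∸ j) λ j<v v< →
      fullAbove j<v (≤-pred (≤-trans v< (≤-reflexive (m+[n∸m]≡n (<⇒≤ (s≤s j<n))))))
    overfull : occupiedAbove O j + count (j <?_) (suc y ∷ xs) ≰ n ∸ j
    overfull rewrite full | count-accept (j <?_) {xs = xs} j<x = m+1+n≰m (n ∸ j)

  suffixBounded⇒parks : ∀ xs → All (λ x → 1 ≤ x × x ≤ n) xs → SuffixBounded n xs → ∃ λ O′ → parkAll n [] xs ≡ just O′
  suffixBounded⇒parks xs bounds suffix = room⇒parks xs bounds λ j j<n _ →
    subst (_≤ n ∸ j) (cong (_+ count (j <?_) xs) (sym (occupied-[] (suc j) (n ∸ j)))) (suffix j j<n)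

-- Balanced vectors

PrefixBounded : ℕ → (n : ℕ) → Vec ℕ n → Set
PrefixBounded m n r = ∀ j → j ≤ n → j ≤ psum r j + (n ∸ m)

nth-++-length : ∀ xs z → nth (xs ++ [ z ]) (length xs) ≡ z
nth-++-length [] z = refl
nth-++-length (x ∷ xs) z = nth-++-length xs z

nth-applyUpTo-++ : ∀ (f : ℕ → ℕ) d ys {i} → i < d → nth (applyUpTo f d ++ ys) i ≡ f i
nth-applyUpTo-++ f (suc d) ys {zero} _ = refl
nth-applyUpTo-++ f (suc d) ys {suc i} (s≤s i<d) = nth-applyUpTo-++ (f ∘ suc) d ys i<d

<-+1⇒≤ : ∀ {j a} → j < a + 1 → j ≤ a
<-+1⇒≤ {a = a} j< = ≤-pred (≤-trans j< (≤-reflexive (+-comm a 1)))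

bracket : ∀ (K : ℕ → ℕ) {j} t → K 0 ≤ j → j < K t → ∃ λ i → i < t × K i ≤ j × j < K (suc i)
bracket K zero K[0]≤j j<K[0] = contradiction K[0]≤j (<⇒≱ j<K[0])
bracket K {j} (suc t) K[0]≤j j<K[1+t] with K t ≤? j
... | yes K[t]≤j = t , ≤-refl , K[t]≤j , j<K[1+t]
... | no  K[t]≰j with bracket K t K[0]≤j (≰⇒> K[t]≰j)
... | i , i<t , K[i]≤j , j<K[1+i] = i , m≤n⇒m≤1+n i<t , K[i]≤j , j<K[1+i]

fullK-last : ∀ n ks → nth (fullK n ks) (suc (length ks)) ≡ suc n
fullK-last n ks = nth-++-length ks (suc n)

balanced⇒prefixBounded : ∀ {m n} (r : Vec ℕ n) → Balanced m n r → PrefixBounded m n r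
balanced⇒prefixBounded {m} {n} r (ks , length-ks , _ , levels , gaps , _) j j≤n
  with bracket (nth (fullK n ks)) (suc (length ks)) z≤n (subst (j <_) (sym (fullK-last n ks)) (s≤s j≤n))
... | i , s≤s i≤length , K[i]≤j , j<K[1+i] = bound (m≤n⇒m<n∨m≡n K[i]≤j)
  where
  d = n ∸ m
  K = nth (fullK n ks)
  i≤d : i ≤ d
  i≤d = subst (i ≤_) length-ks i≤length
  at-level : ∀ i → i ≤ d → K i ≤ psum r (K i) + d
  at-level zero _ = z≤n
  at-level (suc i) 1+i≤d = begin
    K (suc i)                           ≤⟨ m≤n+m∸n (K (suc i)) (suc i) ⟩
    suc i + (K (suc i) ∸ suc i)         ≡⟨ +-comm (suc i) _ ⟩
    (K (suc i) ∸ suc i) + suc i         ≡⟨ cong (_+ suc i) (levels (suc i) (s≤s z≤n) 1+i≤d) ⟨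
    psum r (K (suc i)) + suc i          ≤⟨ +-monoʳ-≤ (psum r (K (suc i))) 1+i≤d ⟩
    psum r (K (suc i)) + d              ∎
    where open ≤-Reasoning
  bound : K i < j ⊎ K i ≡ j → j ≤ psum r j + d
  bound (inj₁ K[i]<j) = ≤-trans (<-+1⇒≤ (gaps i j i≤d K[i]<j j<K[1+i])) (+-monoʳ-≤ (psum r j) i≤d)
  bound (inj₂ refl) = at-level i i≤d

module _ {m n} (r : Vec ℕ n) (m≤n : m ≤ n) (total : psum r n ≡ m) (prefix : PrefixBounded m n r) where

  private
    d = n ∸ m

  Deficit : ℕ → ℕ → Set
  Deficit i j = psum r j + i ≤ j

  -- k_i of the paper; k_0 = 0
  firstDeficit : ℕ → ℕ
  firstDeficit i = search (λ j → psum r j + i ≤? j) n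

  deficit-last : ∀ {i} → i ≤ d → Deficit i n
  deficit-last {i} i≤d = begin
    psum r n + i        ≡⟨ cong (_+ i) total ⟩
    m + i               ≤⟨ +-monoʳ-≤ m i≤d ⟩
    m + d               ≡⟨ m+[n∸m]≡n m≤n ⟩
    n                   ∎
    where open ≤-Reasoning

  firstDeficit-minimal : ∀ {i} → i ≤ d → Minimal (Deficit i) (firstDeficit i)
  firstDeficit-minimal {i} i≤d = search-minimal (λ j → psum r j + i ≤? j) (deficit-last i≤d)

  firstDeficit-zero : firstDeficit 0 ≡ 0
  firstDeficit-zero = n≤0⇒n≡0 (minimal-≤ (firstDeficit-minimal z≤n) z≤n)

  minimal-deficit-level : ∀ {i k} → 1 ≤ i → Minimal (Deficit i) k → psum r k + i ≡ k
  minimal-deficit-level {k = zero} 1≤i (deficit , _) = contradiction (≤-trans 1≤i deficit) λ ()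
  minimal-deficit-level {i} {suc y} _ (deficit , below) = ≤-antisym deficit (begin
    suc y               ≤⟨ ≰⇒> (below ≤-refl) ⟩
    psum r y + i        ≤⟨ +-monoˡ-≤ i (psum-mono r (n≤1+n y)) ⟩
    psum r (suc y) + i  ∎)
    where open ≤-Reasoning

  minimal-deficit-< : ∀ {i k k′} → Minimal (Deficit i) k → Minimal (Deficit (suc i)) k′ → k < k′
  minimal-deficit-< {k′ = zero} _ (() , _)
  minimal-deficit-< {i} {k} {suc y} k-min (deficit′ , _) = s≤s (minimal-≤ k-min (≤-pred (begin
    suc (psum r y + i)        ≤⟨ s≤s (+-monoˡ-≤ i (psum-mono r (n≤1+n y))) ⟩
    suc (psum r (suc y) + i)  ≡⟨ +-suc _ i ⟨
    psum r (suc y) + suc i    ≤⟨ deficit′ ⟩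
    suc y                     ∎)))
    where open ≤-Reasoning

  deficitPositions : List ℕ
  deficitPositions = applyUpTo (firstDeficit ∘ suc) d

  private
    K = nth (fullK n deficitPositions)

  K≡firstDeficit : ∀ {i} → i ≤ d → K i ≡ firstDeficit i
  K≡firstDeficit {zero} _ = sym firstDeficit-zero
  K≡firstDeficit {suc i} 1+i≤d = nth-applyUpTo-++ (firstDeficit ∘ suc) d [ suc n ] 1+i≤d

  K-last : K (suc d) ≡ suc n
  K-last = subst (λ t → K (suc t) ≡ suc n) (length-applyUpTo (firstDeficit ∘ suc) d) (fullK-last n deficitPositions)

  K-increasing : ∀ i → i ≤ d → K i < K (suc i)
  K-increasing i i≤d with m≤n⇒m<n∨m≡n i≤d
  ... | inj₁ i<d = subst₂ _<_ (sym (K≡firstDeficit i≤d)) (sym (K≡firstDeficit i<d))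
                     (minimal-deficit-< (firstDeficit-minimal i≤d) (firstDeficit-minimal i<d))
  ... | inj₂ refl = subst₂ _<_ (sym (K≡firstDeficit i≤d)) (sym K-last)
                      (s≤s (minimal-≤ (firstDeficit-minimal i≤d) (deficit-last i≤d)))

  K-level : ∀ i → 1 ≤ i → i ≤ d → psum r (K i) ≡ K i ∸ i
  K-level i 1≤i i≤d rewrite K≡firstDeficit i≤d =
    trans (sym (m+n∸n≡m _ i)) (cong (_∸ i) (minimal-deficit-level 1≤i (firstDeficit-minimal i≤d)))

  K-gap : ∀ i j → i ≤ d → K i < j → j < K (suc i) → j < psum r j + i + 1
  K-gap i j i≤d _ j<K[1+i] with m≤n⇒m<n∨m≡n i≤d
  ... | inj₁ i<d = subst (j <_) (trans (+-suc _ i) (+-comm 1 _))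
                     (≰⇒> (proj₂ (firstDeficit-minimal i<d) (subst (j <_) (K≡firstDeficit i<d) j<K[1+i])))
  ... | inj₂ refl = subst (j <_) (+-comm 1 _)
                      (s≤s (prefix j (≤-pred (subst (j <_) K-last j<K[1+i]))))

  prefixBounded⇒balanced : Balanced m n r
  prefixBounded⇒balanced = deficitPositions , length-applyUpTo (firstDeficit ∘ suc) d ,
                           K-increasing , K-level , K-gap , total

-- Specification and order permutation

all-toList : ∀ {A : Set} {P : Pred A 0ℓ} {m} (v : Vec A m) → (∀ i → P (lookup v i)) → All P (toList v)
all-toList {P = P} v h = subst (All P) (sym (toList-lookup v)) (AllP.tabulate⁺ h)

count-≤-suc : ∀ j (xs : List ℕ) → count (_≤? suc j) xs ≡ count (_≤? j) xs + count (_≟ suc j) xs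
count-≤-suc j xs = begin
  count (_≤? suc j) xs                                                        ≡⟨ count-split (_≤? suc j) (_≤? j) xs ⟩
  count ((_≤? suc j) ∩? (_≤? j)) xs + count ((_≤? suc j) ∩? ∁? (_≤? j)) xs    ≡⟨ cong₂ _+_ (count-cong _ (_≤? j) below xs) (count-cong _ (_≟ suc j) at xs) ⟩
  count (_≤? j) xs + count (_≟ suc j) xs                                      ∎
  where
  open ≡-Reasoning
  below : (λ x → x ≤ suc j × x ≤ j) ≐ (_≤ j)
  below = proj₂ , λ x≤j → m≤n⇒m≤1+n x≤j , x≤j
  at : (λ x → x ≤ suc j × ¬ x ≤ j) ≐ (_≡ suc j)
  at = (λ (x≤1+j , x≰j) → ≤-antisym x≤1+j (≰⇒> x≰j)) , λ { refl → ≤-refl , <-irrefl refl }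

module _ {m} (n : ℕ) (π : Vec ℕ m) where

  psum-spec-suc : ∀ {j} → j < n → psum (spec n π) (suc j) ≡ psum (spec n π) j + count (_≟ suc j) (toList π)
  psum-spec-suc {j} j<n = begin
    psum (spec n π) (suc j)                                ≡⟨ cong (psum (spec n π) ∘ suc) toℕ[i]≡j ⟨
    psum (spec n π) (suc (toℕ i))                          ≡⟨ psum-suc (spec n π) i ⟩
    psum (spec n π) (toℕ i) + lookup (spec n π) i          ≡⟨ cong₂ _+_ (cong (psum (spec n π)) toℕ[i]≡j) (lookup∘tabulate _ i) ⟩
    psum (spec n π) j + count (_≟ suc (toℕ i)) (toList π)  ≡⟨ cong (λ t → psum (spec n π) j + count (_≟ suc t) (toList π)) toℕ[i]≡j ⟩
    psum (spec n π) j + count (_≟ suc j) (toList π)        ∎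
    where
    open ≡-Reasoning
    i = fromℕ< j<n
    toℕ[i]≡j = toℕ-fromℕ< j<n

  psum-spec : (∀ i → 1 ≤ lookup π i) → ∀ j → j ≤ n → psum (spec n π) j ≡ count (_≤? j) (toList π)
  psum-spec positive zero _ =
    sym (cong length (filter-none (_≤? 0) (all-toList π λ i x≤0 → contradiction (≤-trans (positive i) x≤0) λ ())))
  psum-spec positive (suc j) 1+j≤n = begin
    psum (spec n π) (suc j)                                   ≡⟨ psum-spec-suc 1+j≤n ⟩
    psum (spec n π) j + count (_≟ suc j) (toList π)           ≡⟨ cong (_+ count (_≟ suc j) (toList π)) (psum-spec positive j (<⇒≤ 1+j≤n)) ⟩
    count (_≤? j) (toList π) + count (_≟ suc j) (toList π)    ≡⟨ count-≤-suc j (toList π) ⟨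
    count (_≤? suc j) (toList π)                              ∎
    where open ≡-Reasoning

-- the order behind ord: lexicographic in (preference, arrival index)
_≤ₗₑₓ_ : Rel (ℕ × ℕ) 0ℓ
_≤ₗₑₓ_ = Lex.×-Lex _≡_ _<_ _≤_

_≤ₗₑₓ?_ : Decidable₂ _≤ₗₑₓ_
_≤ₗₑₓ?_ = Lex.×-decidable _≟_ _<?_ _≤?_

≤ₗₑₓ-refl : ∀ {x} → x ≤ₗₑₓ x
≤ₗₑₓ-refl = inj₂ (refl , ≤-refl)

≤ₗₑₓ-trans : Transitive _≤ₗₑₓ_
≤ₗₑₓ-trans = Lex.×-transitive {_≈₁_ = _≡_} {_<₁_ = _<_} {_<₂_ = _≤_} isEquivalence <-resp₂-≡ <-trans ≤-trans

≤ₗₑₓ-total : Total _≤ₗₑₓ_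
≤ₗₑₓ-total = Lex.×-total₂ {_≈₁_ = _≡_} {_<₁_ = _<_} {_<₂_ = _≤_} sym <-cmp ≤-total

≤ₗₑₓ-antisym : ∀ {x y} → x ≤ₗₑₓ y → y ≤ₗₑₓ x → x ≡ y
≤ₗₑₓ-antisym x≤y y≤x = ×-≡,≡→≡
  (Lex.×-antisymmetric {_≈₁_ = _≡_} {_<₁_ = _<_} {_≈₂_ = _≡_} {_<₂_ = _≤_} sym <-irrefl <-asym ≤-antisym x≤y y≤x)

key : ∀ {m} → Vec ℕ m → Fin m → ℕ × ℕ
key π i = lookup π i , toℕ i

rank : ∀ {m} → Vec ℕ m → Fin m → ℕ
rank {m} π i = count (λ j → key π j ≤ₗₑₓ? key π i) (List.allFin m)

module _ {m} (π : Vec ℕ m) where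

  lookup-ord : ∀ i → lookup (ord π) i ≡ rank π i
  lookup-ord i = trans (lookup∘tabulate _ i) (cong (count (λ j → key π j ≤ₗₑₓ? key π i)) (toList-tabulate id))

  rank-< : ∀ {i j} → key π j ≤ₗₑₓ key π i → ¬ key π i ≤ₗₑₓ key π j → rank π j < rank π i
  rank-< {i} {j} j≤i i≰j = count-< (λ k → key π k ≤ₗₑₓ? key π j) (λ k → key π k ≤ₗₑₓ? key π i)
                             (λ k≤j → ≤ₗₑₓ-trans k≤j j≤i) (∈-allFin i) ≤ₗₑₓ-refl i≰j

  rank-injective : ∀ {i j} → rank π i ≡ rank π j → i ≡ j
  rank-injective {i} {j} eq with key π i ≤ₗₑₓ? key π j | key π j ≤ₗₑₓ? key π i
  ... | yes i≤j | yes j≤i = toℕ-injective (cong proj₂ (≤ₗₑₓ-antisym i≤j j≤i))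
  ... | yes i≤j | no  j≰i = contradiction eq (<⇒≢ (rank-< i≤j j≰i))
  ... | no  i≰j | yes j≤i = contradiction (sym eq) (<⇒≢ (rank-< j≤i i≰j))
  ... | no  i≰j | no  j≰i = ⊥-elim ([ i≰j , j≰i ]′ (≤ₗₑₓ-total (key π i) (key π j)))

  rank-positive : ∀ i → 1 ≤ rank π i
  rank-positive i = filter-some (λ j → key π j ≤ₗₑₓ? key π i) (Any.map (λ { refl → ≤ₗₑₓ-refl }) (∈-allFin i))

  rank-≤ : ∀ i → rank π i ≤ m
  rank-≤ i = count-allFin-≤ (λ j → key π j ≤ₗₑₓ? key π i)

  private
    ∸1-< : ∀ {x} → 1 ≤ x → x ∸ 1 < x
    ∸1-< {suc x} _ = ≤-refl

  rank-inBlock : ∀ {n} → (∀ i → 1 ≤ lookup π i) → ∀ i → lookup π i ≤ n → InBlock (spec n π) (lookup π i) (rank π i)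
  rank-inBlock {n} positive i πᵢ≤n = lower , upper
    where
    open ≤-Reasoning
    πᵢ = lookup π i
    upper : rank π i ≤ psum (spec n π) πᵢ
    upper = begin
      rank π i                                             ≤⟨ count-mono (λ j → key π j ≤ₗₑₓ? key π i) (λ j → lookup π j ≤? πᵢ) [ <⇒≤ , ≤-reflexive ∘ proj₁ ]′ (List.allFin m) ⟩
      count (λ j → lookup π j ≤? πᵢ) (List.allFin m)       ≡⟨ count-toList (_≤? πᵢ) π ⟨
      count (_≤? πᵢ) (toList π)                            ≡⟨ psum-spec n π positive πᵢ πᵢ≤n ⟨
      psum (spec n π) πᵢ                                   ∎
    lower : psum (spec n π) (πᵢ ∸ 1) < rank π i
    lower = begin-strict
      psum (spec n π) (πᵢ ∸ 1)                             ≡⟨ psum-spec n π positive (πᵢ ∸ 1) (≤-trans (m∸n≤m πᵢ 1) πᵢ≤n) ⟩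
      count (_≤? πᵢ ∸ 1) (toList π)                        ≡⟨ count-toList (_≤? πᵢ ∸ 1) π ⟩
      count (λ j → lookup π j ≤? πᵢ ∸ 1) (List.allFin m)   <⟨ count-< (λ j → lookup π j ≤? πᵢ ∸ 1) (λ j → key π j ≤ₗₑₓ? key π i)
                                                                (λ πⱼ≤ → inj₁ (≤-<-trans πⱼ≤ (∸1-< (positive i))))
                                                                (∈-allFin i) ≤ₗₑₓ-refl (<⇒≱ (∸1-< (positive i))) ⟩
      rank π i                                             ∎

module _ {j m n L G : ℕ} (L+G≡m : L + G ≡ m) where

  suffix⇒prefix-bound : j ≤ n → G ≤ n ∸ j → j ≤ L + (n ∸ m)
  suffix⇒prefix-bound j≤n G≤n∸j = +-cancelʳ-≤ m j (L + (n ∸ m)) (begin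
    j + m                ≡⟨ cong (j +_) L+G≡m ⟨
    j + (L + G)          ≡⟨ solve 3 (λ j L G → j :+ (L :+ G) := L :+ (G :+ j)) refl j L G ⟩
    L + (G + j)          ≤⟨ +-monoʳ-≤ L (m≤o∸n⇒m+n≤o G j≤n G≤n∸j) ⟩
    L + n                ≤⟨ +-monoʳ-≤ L (m≤n+m∸n n m) ⟩
    L + (m + (n ∸ m))    ≡⟨ solve 3 (λ L m d → L :+ (m :+ d) := L :+ d :+ m) refl L m (n ∸ m) ⟩
    L + (n ∸ m) + m      ∎)
    where open ≤-Reasoning

  prefix⇒suffix-bound : m ≤ n → j ≤ L + (n ∸ m) → G ≤ n ∸ j
  prefix⇒suffix-bound m≤n j≤ = m+n≤o⇒m≤o∸n G (begin
    G + j                ≤⟨ +-monoʳ-≤ G j≤ ⟩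
    G + (L + (n ∸ m))    ≡⟨ solve 3 (λ G L d → G :+ (L :+ d) := L :+ G :+ d) refl G L (n ∸ m) ⟩
    L + G + (n ∸ m)      ≡⟨ cong (_+ (n ∸ m)) L+G≡m ⟩
    m + (n ∸ m)          ≡⟨ m+[n∸m]≡n m≤n ⟩
    n                    ∎)
    where open ≤-Reasoning

count-≤+count-> : ∀ j (xs : List ℕ) → count (_≤? j) xs + count (j <?_) xs ≡ length xs
count-≤+count-> j xs = trans (cong (count (_≤? j) xs +_) (count-cong (j <?_) (∁? (_≤? j)) (<⇒≱ , ≰⇒>) xs))
                             (count-complement (_≤? j) xs)

module _ {m n} (m≤n : m ≤ n) (π : Vec ℕ m) where

  private
    split : ∀ j → count (_≤? j) (toList π) + count (j <?_) (toList π) ≡ m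
    split j = trans (count-≤+count-> j (toList π)) (length-toList π)

  total-spec : (∀ i → 1 ≤ lookup π i × lookup π i ≤ n) → psum (spec n π) n ≡ m
  total-spec bounds = begin
    psum (spec n π) n            ≡⟨ psum-spec n π (proj₁ ∘ bounds) n ≤-refl ⟩
    count (_≤? n) (toList π)     ≡⟨ cong length (filter-all (_≤? n) (all-toList π (proj₂ ∘ bounds))) ⟩
    length (toList π)            ≡⟨ length-toList π ⟩
    m                            ∎
    where open ≡-Reasoning

  suffixBounded⇒prefixBounded : (∀ i → 1 ≤ lookup π i × lookup π i ≤ n) →
                                SuffixBounded n (toList π) → PrefixBounded m n (spec n π)
  suffixBounded⇒prefixBounded bounds suffix j j≤n with m≤n⇒m<n∨m≡n j≤n
  ... | inj₁ j<n = subst (λ t → j ≤ t + (n ∸ m)) (sym (psum-spec n π (proj₁ ∘ bounds) j j≤n))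
                     (suffix⇒prefix-bound (split j) j≤n (suffix j j<n))
  ... | inj₂ refl = subst (λ t → j ≤ t + (j ∸ m)) (sym (total-spec bounds)) (≤-reflexive (sym (m+[n∸m]≡n m≤n)))

  prefixBounded⇒suffixBounded : (∀ i → 1 ≤ lookup π i) →
                                PrefixBounded m n (spec n π) → SuffixBounded n (toList π)
  prefixBounded⇒suffixBounded positive prefix j j<n =
    prefix⇒suffix-bound (split j) m≤n (subst (λ t → j ≤ t + (n ∸ m)) (psum-spec n π positive j (<⇒≤ j<n)) (prefix j (<⇒≤ j<n)))

-- From parking functions to compatible pairs

ord-isPerm : ∀ {m} (π : Vec ℕ m) → IsPerm m (ord π)
ord-isPerm π = (λ i → subst (λ t → 1 ≤ t × t ≤ _) (sym (lookup-ord π i)) (rank-positive π i , rank-≤ π i))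
             , λ i j eq → rank-injective π (trans (sym (lookup-ord π i)) (trans eq (lookup-ord π j)))

ord-compatible : ∀ {m n} (π : Vec ℕ m) → (∀ i → 1 ≤ lookup π i × lookup π i ≤ n) → Compatible (spec n π) (ord π)
ord-compatible {n = n} π bounds k 1≤k _ i j i<j lᵢ uᵢ lⱼ uⱼ =
  subst₂ _<_ (sym (lookup-ord π i)) (sym (lookup-ord π j)) (rank-< π i≤j j≰i)
  where
  inBlock : ∀ i → InBlock (spec n π) k (lookup (ord π) i) → lookup π i ≡ k
  inBlock i block = inBlock-unique (spec n π) (proj₁ (bounds i)) 1≤k
    (rank-inBlock π (proj₁ ∘ bounds) i (proj₂ (bounds i))) (subst (InBlock (spec n π) k) (lookup-ord π i) block)
  πᵢ≡πⱼ : lookup π i ≡ lookup π j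
  πᵢ≡πⱼ = trans (inBlock i (lᵢ , uᵢ)) (sym (inBlock j (lⱼ , uⱼ)))
  i≤j : key π i ≤ₗₑₓ key π j
  i≤j = inj₂ (πᵢ≡πⱼ , <⇒≤ i<j)
  j≰i : ¬ key π j ≤ₗₑₓ key π i
  j≰i (inj₁ πⱼ<πᵢ) = <-irrefl (sym πᵢ≡πⱼ) πⱼ<πᵢ
  j≰i (inj₂ (_ , j≤i)) = <⇒≱ i<j j≤i

parkingFunction⇒inC : ∀ {m n} → m ≤ n → (π : Vec ℕ m) → IsPF m n π → InC m n (spec n π) (ord π)
parkingFunction⇒inC {m} {n} m≤n π (bounds , _ , parks) =
  ord-isPerm π , ord-compatible π bounds ,
  prefixBounded⇒balanced (spec n π) m≤n (total-spec m≤n π bounds)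
    (suffixBounded⇒prefixBounded m≤n π bounds (parks⇒suffixBounded n (toList π) parks))

spec-ord-injective : ∀ {m n} (π π′ : Vec ℕ m) → IsPF m n π → IsPF m n π′ →
                     spec n π ≡ spec n π′ → ord π ≡ ord π′ → π ≡ π′
spec-ord-injective {n = n} π π′ (bounds , _) (bounds′ , _) spec≡ ord≡ = vec-ext λ i →
  inBlock-unique (spec n π) (proj₁ (bounds i)) (proj₁ (bounds′ i))
    (rank-inBlock π (proj₁ ∘ bounds) i (proj₂ (bounds i)))
    (subst₂ (λ r x → InBlock r (lookup π′ i) x) (sym spec≡) (rank≡ i)
       (rank-inBlock π′ (proj₁ ∘ bounds′) i (proj₂ (bounds′ i))))
  where
  rank≡ : ∀ i → rank π′ i ≡ rank π i
  rank≡ i = trans (sym (lookup-ord π′ i)) (trans (cong (λ σ → lookup σ i) (sym ord≡)) (lookup-ord π i))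

-- From compatible pairs back to parking functions

perm-count-≤ : ∀ {m} (σ : Vec ℕ m) → IsPerm m σ → ∀ {v} → v ≤ m → count (_≤? v) (toList σ) ≡ v
perm-count-≤ {m} σ (bounds , injective) {v} v≤m = ≤-antisym A≤v (+-cancelʳ-≤ B v A (begin
  v + B               ≤⟨ +-monoʳ-≤ v B≤m∸v ⟩
  v + (m ∸ v)         ≡⟨ m+[n∸m]≡n v≤m ⟩
  m                   ≡⟨ trans (count-≤+count-> v (toList σ)) (length-toList σ) ⟨
  A + B               ∎))
  where
  open ≤-Reasoning
  A = count (_≤? v) (toList σ)
  B = count (v <?_) (toList σ)
  unique : Unique (toList σ)
  unique = subst Unique (sym (toList-lookup σ)) (Unique.tabulate⁺ (λ {i} {j} → injective i j))
  in-range : All (λ x → 1 ≤ x × x ≤ m) (toList σ)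
  in-range = all-toList σ bounds
  A≤v : A ≤ v
  A≤v = unique-length-≤ v (Unique.filter⁺ (_≤? v) unique)
          (All.map (λ ((1≤x , _) , x≤v) → 1≤x , s≤s x≤v) (all-filter (_≤? v) in-range))
  B≤m∸v : B ≤ m ∸ v
  B≤m∸v = unique-length-≤ (m ∸ v) (Unique.filter⁺ (v <?_) unique)
            (All.map (λ ((_ , x≤m) , v<x) → v<x , s≤s (≤-trans x≤m (≤-reflexive (sym (m+[n∸m]≡n v≤m)))))
              (all-filter (v <?_) in-range))

module Inverse {m n} (m≤n : m ≤ n) (r : Vec ℕ n) (σ : Vec ℕ m)
               (perm : IsPerm m σ) (compatible : Compatible r σ) (balanced : Balanced m n r) where

  total : psum r n ≡ m
  total = proj₂ (proj₂ (proj₂ (proj₂ (proj₂ balanced))))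

  block : ℕ → ℕ
  block x = search (λ k → x ≤? psum r k) n

  block-minimal : ∀ {x} → x ≤ m → Minimal (λ k → x ≤ psum r k) (block x)
  block-minimal {x} x≤m = search-minimal (λ k → x ≤? psum r k) {n} (subst (x ≤_) (sym total) x≤m)

  minimal-inBlock : ∀ {x k} → 1 ≤ x → Minimal (λ k → x ≤ psum r k) k → 1 ≤ k × InBlock r k x
  minimal-inBlock {k = zero} 1≤x (x≤0 , _) = contradiction (≤-trans 1≤x x≤0) λ ()
  minimal-inBlock {k = suc y} _ (x≤S , below) = s≤s z≤n , ≰⇒> (below ≤-refl) , x≤S

  π : Vec ℕ m
  π = V.tabulate (block ∘ lookup σ)

  lookup-π : ∀ i → lookup π i ≡ block (lookup σ i)
  lookup-π i = lookup∘tabulate (block ∘ lookup σ) i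

  σ-bounds : ∀ i → 1 ≤ lookup σ i × lookup σ i ≤ m
  σ-bounds = proj₁ perm

  π-minimal : ∀ i → Minimal (λ k → lookup σ i ≤ psum r k) (lookup π i)
  π-minimal i = subst (Minimal _) (sym (lookup-π i)) (block-minimal (proj₂ (σ-bounds i)))

  π-inBlock : ∀ i → 1 ≤ lookup π i × InBlock r (lookup π i) (lookup σ i)
  π-inBlock i = minimal-inBlock (proj₁ (σ-bounds i)) (π-minimal i)

  π-bounds : ∀ i → 1 ≤ lookup π i × lookup π i ≤ n
  π-bounds i = proj₁ (π-inBlock i) , minimal-≤ (π-minimal i) (subst (lookup σ i ≤_) (sym total) (proj₂ (σ-bounds i)))

  π-≤⇒ : ∀ {i j} → lookup π i ≤ j → lookup σ i ≤ psum r j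
  π-≤⇒ {i} πᵢ≤j = ≤-trans (proj₂ (proj₂ (π-inBlock i))) (psum-mono r πᵢ≤j)

  ⇒π-≤ : ∀ {i j} → lookup σ i ≤ psum r j → lookup π i ≤ j
  ⇒π-≤ {i} = minimal-≤ (π-minimal i)

  spec-π : spec n π ≡ r
  spec-π = psum-injective λ j j≤n → begin
    psum (spec n π) j                                         ≡⟨ psum-spec n π (proj₁ ∘ π-bounds) j j≤n ⟩
    count (_≤? j) (toList π)                                  ≡⟨ count-toList (_≤? j) π ⟩
    count (λ i → lookup π i ≤? j) (List.allFin m)             ≡⟨ count-cong _ (λ i → lookup σ i ≤? psum r j) (π-≤⇒ , ⇒π-≤) (List.allFin m) ⟩
    count (λ i → lookup σ i ≤? psum r j) (List.allFin m)      ≡⟨ count-toList (_≤? psum r j) σ ⟨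
    count (_≤? psum r j) (toList σ)                           ≡⟨ perm-count-≤ σ perm (≤-trans (psum-mono r {b = n} j≤n) (≤-reflexive total)) ⟩
    psum r j                                                  ∎
    where open ≡-Reasoning

  compatible-at : ∀ {i j} → lookup π i ≡ lookup π j → toℕ i < toℕ j → lookup σ i < lookup σ j
  compatible-at {i} {j} πᵢ≡πⱼ i<j =
    compatible (lookup π i) (proj₁ (π-bounds i)) (proj₂ (π-bounds i)) i j i<j
      (proj₁ blockᵢ) (proj₂ blockᵢ) (proj₁ blockⱼ) (proj₂ blockⱼ)
    where
    blockᵢ = proj₂ (π-inBlock i)
    blockⱼ : InBlock r (lookup π i) (lookup σ j)
    blockⱼ = subst (λ k → InBlock r k (lookup σ j)) (sym πᵢ≡πⱼ) (proj₂ (π-inBlock j))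

  key-≤⇒ : ∀ {i j} → key π j ≤ₗₑₓ key π i → lookup σ j ≤ lookup σ i
  key-≤⇒ {i} {j} (inj₁ πⱼ<πᵢ) = <⇒≤ (≤-<-trans (π-≤⇒ (∸-monoˡ-≤ 1 πⱼ<πᵢ)) (proj₁ (proj₂ (π-inBlock i))))
  key-≤⇒ {i} {j} (inj₂ (πⱼ≡πᵢ , j≤i)) with m≤n⇒m<n∨m≡n j≤i
  ... | inj₁ j<i = <⇒≤ (compatible-at πⱼ≡πᵢ j<i)
  ... | inj₂ j≡i = ≤-reflexive (cong (lookup σ) (toℕ-injective j≡i))

  ⇒key-≤ : ∀ {i j} → lookup σ j ≤ lookup σ i → key π j ≤ₗₑₓ key π i
  ⇒key-≤ {i} {j} σⱼ≤σᵢ with m≤n⇒m<n∨m≡n (⇒π-≤ (≤-trans σⱼ≤σᵢ (proj₂ (proj₂ (π-inBlock i)))))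
  ... | inj₁ πⱼ<πᵢ = inj₁ πⱼ<πᵢ
  ... | inj₂ πⱼ≡πᵢ with toℕ j ≤? toℕ i
  ...   | yes j≤i = inj₂ (πⱼ≡πᵢ , j≤i)
  ...   | no  j≰i = contradiction σⱼ≤σᵢ (<⇒≱ (compatible-at (sym πⱼ≡πᵢ) (≰⇒> j≰i)))

  ord-π : ord π ≡ σ
  ord-π = vec-ext λ i → begin
    lookup (ord π) i                                          ≡⟨ lookup-ord π i ⟩
    rank π i                                                  ≡⟨ count-cong _ (λ j → lookup σ j ≤? lookup σ i) (key-≤⇒ , ⇒key-≤) (List.allFin m) ⟩
    count (λ j → lookup σ j ≤? lookup σ i) (List.allFin m)    ≡⟨ count-toList (_≤? lookup σ i) σ ⟨
    count (_≤? lookup σ i) (toList σ)                         ≡⟨ perm-count-≤ σ perm (proj₂ (σ-bounds i)) ⟩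
    lookup σ i                                                ∎
    where open ≡-Reasoning

  π-isPF : IsPF m n π
  π-isPF = π-bounds , suffixBounded⇒parks n (toList π) (all-toList π π-bounds)
             (prefixBounded⇒suffixBounded m≤n π (proj₁ ∘ π-bounds)
               (subst (PrefixBounded m n) (sym spec-π) (balanced⇒prefixBounded r balanced)))

theorem2p3 : (m n : ℕ) → 1 ≤ m → m ≤ n →
    ((π : Vec ℕ m) → IsPF m n π → InC m n (spec n π) (ord π))
    × ((π π′ : Vec ℕ m) → IsPF m n π → IsPF m n π′ →
         spec n π ≡ spec n π′ → ord π ≡ ord π′ → π ≡ π′)
    × ((r : Vec ℕ n) (σ : Vec ℕ m) → InC m n r σ →
         Σ (Vec ℕ m) (λ π → IsPF m n π × spec n π ≡ r × ord π ≡ σ))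
theorem2p3 m n _ m≤n =
  parkingFunction⇒inC m≤n ,
  spec-ord-injective ,
  λ r σ (perm , compatible , balanced) → let open Inverse m≤n r σ perm compatible balanced in
    π , π-isPF , spec-π , ord-π
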